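{- (a) For all integers $n\ge1$ and $k\ge0$, \[T(2,n;k)=T(2,n-2;k-1)+T(2,n-1;k-1)+T(2,n-1;k).\] (b) For all integers $n\ge1$ and $0\le k\le n$, \[T(2,n;k)=T(2,n-1;k)+\sum_{r=1}^k 2\,T(2,n-r-1;k-r).\]
   Context: For integers $n\ge0$ and $k\ge0$, $T(2,n;k)$ denotes the number of ways to select a set of $k$ squares from a $2\times n$ rectangular grid of unit squares ($2$ rows, $n$ columns) such that no two selected squares are horizontally or vertically adjacent (share an edge); in particular $T(2,0;0)=1$, and $T(2,n;k)=0$ if $k>n$. Boundary conventions: $T(2,n;k)=0$ whenever $k<0$; $T(2,-1;0)=1$ and $T(2,-1;k)=0$ for $k\ne0$. -}

module Defs where

open import Data.Bool using (Bool; true; false; _∧_; _∨_; not; if_then_else_)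
open import Data.Nat using (ℕ; zero; suc; _≡ᵇ_)
open import Data.Fin using (Fin; toℕ)
open import Data.Fin.Base using () renaming (zero to fz; suc to fs)
open import Data.Vec using (Vec; []; _∷_; lookup)
open import Data.List using (List; []; _∷_; [_]; concatMap; map; foldr)
open import Data.Nat.ListAction using (sum)
open import Data.List.Base using (allFin)
open import Data.Integer using (ℤ; +_; -[1+_])
open import Data.Product using (_×_; _,_)

-- A cell of the 2 × n grid: (row, column).
Cell : ℕ → Set
Cell n = Fin 2 × Fin n

Selection : ℕ → Set
Selection n = Cell n → Bool

cells : (n : ℕ) → List (Cell n)
cells n = concatMap (λ i → map (λ j → (i , j)) (allFin n)) (allFin 2)

adjacent : {n : ℕ} → Cell n → Cell n → Bool
adjacent (i , j) (i' , j') =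
  ((toℕ i ≡ᵇ toℕ i') ∧ ((suc (toℕ j) ≡ᵇ toℕ j') ∨ (suc (toℕ j') ≡ᵇ toℕ j)))
  ∨ ((toℕ j ≡ᵇ toℕ j') ∧ not (toℕ i ≡ᵇ toℕ i'))

allB : {A : Set} → (A → Bool) → List A → Bool
allB p = foldr (λ x b → p x ∧ b) true

nonAdjacent : {n : ℕ} → Selection n → Bool
nonAdjacent {n} S =
  allB (λ c → allB (λ c' → not (adjacent c c' ∧ S c ∧ S c')) (cells n)) (cells n)

size : {n : ℕ} → Selection n → ℕ
size {n} S = sum (map (λ c → if S c then 1 else 0) (cells n))

allVecs : (n : ℕ) → List (Vec Bool n)
allVecs zero = [ [] ]
allVecs (suc n) = concatMap (λ v → (true ∷ v) ∷ (false ∷ v) ∷ []) (allVecs n)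

selections : (n : ℕ) → List (Selection n)
selections n =
  concatMap (λ r₀ → map (λ r₁ → sel r₀ r₁) (allVecs n)) (allVecs n)
  where
  sel : Vec Bool n → Vec Bool n → Selection n
  sel r₀ r₁ (fz , j)      = lookup r₀ j
  sel r₀ r₁ (fs _ , j)    = lookup r₁ j

T2 : ℕ → ℕ → ℕ
T2 n k = sum (map (λ S → if nonAdjacent S ∧ (size S ≡ᵇ k) then 1 else 0) (selections n))

-- T(2,n;k) for integer arguments with the boundary conventions:
-- T(2,n;k) = 0 for k < 0; T(2,-1;0) = 1, T(2,-1;k) = 0 for k ≠ 0.
-- (n < -1 never occurs in the statement; it is set to 0 there.)
T : ℤ → ℤ → ℕ
T (+ n) (+ k) = T2 n k
T (+ n) -[1+ _ ] = 0
T -[1+ zero ] (+ zero) = 1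
T -[1+ zero ] (+ suc _) = 0
T -[1+ zero ] -[1+ _ ] = 0
T -[1+ suc _ ] _ = 0

module Submission where

-- A selection of the 2 × n grid is described by its two rows r₀, r₁.  For
-- a, b : Bool (the occupied cells of a fictitious column to the left of the
-- grid) let N n a b k count the independent k-selections of the 2 × n grid
-- that are also independent of that column.  Write F, U, L, E for N with
-- (a,b) = (no,no), (yes,no), (no,yes), (yes,yes); then F n k = T(2,n;k) and
-- E n k = T(2,n-1;k).  Removing the first column (empty, top cell only, or
-- bottom cell only; both cells is never allowed) gives
--   N (n+1) a b k = [¬a] U n (k-1) + [¬b] L n (k-1) + F n k.
-- Everything follows from this and the symmetry U = L:
--   (a)  U n k + L n k = E n k + F n k, hence F(n+1,k+1) = E(n,k) + F(n,k) + F(n,k+1);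
--   (b)  U n k = Σ_{i ≤ k} E(n-i, k-i) for k ≤ n, hence F(n+1,k) = F(n,k) + 2 U(n,k-1).

open import Defs
open import Data.Nat using (ℕ; suc; _≤_; _*_; _+_)
open import Data.Integer using (+_; _-_)
open import Data.List using (map; applyUpTo)
open import Data.Nat.ListAction using (sum)
open import Data.Product using (_×_)
open import Relation.Binary.PropositionalEquality using (_≡_)

open import Algebra.Properties.CommutativeSemigroup using (interchange)
open import Data.Bool using (Bool; true; false; _∧_; not; if_then_else_)
open import Data.Bool.Properties using (∧-comm; ∧-zeroʳ; ⇔→≡)
open import Data.Fin using (Fin) renaming (zero to fz; suc to fs)
open import Data.Integer using (-[1+_])
open import Data.Integer.Properties using (⊖-≥; [1+m]⊖[1+n]≡m⊖n)
open import Data.List using (List; []; _∷_; _++_; concatMap; tabulate)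
open import Data.List.Base using (allFin)
open import Data.List.Membership.Propositional using (_∈_)
open import Data.List.Membership.Propositional.Properties using (∈-map⁺; ∈-++⁺ˡ; ∈-++⁺ʳ; ∈-allFin)
open import Data.List.Properties using (map-cong; map-∘; map-++; map-tabulate; map-applyUpTo)
open import Data.List.Relation.Unary.Any using (here; there)
open import Data.Nat using (zero; _∸_; _≡ᵇ_; _<_; z≤n; s≤s)
open import Data.Nat.ListAction.Properties using (sum-++)
open import Data.Nat.Properties using (+-assoc; +-comm; +-identityʳ; *-zeroʳ; *-distribˡ-+; ≤-trans; +-commutativeSemigroup)
open import Data.Nat.Tactic.RingSolver using (solve-∀)
open import Data.Product using (_,_)
open import Data.Vec using (Vec; []; _∷_; lookup)
open import Function.Bundles using (_⇔_; mk⇔; Equivalence)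
open import Relation.Binary.PropositionalEquality
  using (refl; cong; cong₂; sym; trans; subst₂; _≗_; module ≡-Reasoning)
open ≡-Reasoning

sum-map-+ : ∀ {A : Set} (f g : A → ℕ) (xs : List A) →
            sum (map (λ x → f x + g x) xs) ≡ sum (map f xs) + sum (map g xs)
sum-map-+ f g [] = refl
sum-map-+ f g (x ∷ xs) = begin
  (f x + g x) + sum (map (λ x → f x + g x) xs)     ≡⟨ cong (_+_ ((f x + g x))) (sum-map-+ f g xs) ⟩
  (f x + g x) + (sum (map f xs) + sum (map g xs)) ≡⟨ interchange +-commutativeSemigroup (f x) (g x) _ _ ⟩
  (f x + sum (map f xs)) + (g x + sum (map g xs)) ∎

sum-map-* : ∀ {A : Set} (c : ℕ) (f : A → ℕ) (xs : List A) →
            sum (map (λ x → c * f x) xs) ≡ c * sum (map f xs)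
sum-map-* c f [] = sym (*-zeroʳ c)
sum-map-* c f (x ∷ xs) =
  trans (cong (_+_ (c * f x)) (sum-map-* c f xs)) (sym (*-distribˡ-+ c (f x) _))

sum-map-zero : ∀ {A : Set} (xs : List A) → sum (map (λ _ → 0) xs) ≡ 0
sum-map-zero [] = refl
sum-map-zero (x ∷ xs) = sum-map-zero xs

sum-map-concatMap : ∀ {A B : Set} (f : B → ℕ) (g : A → List B) (xs : List A) →
                    sum (map f (concatMap g xs)) ≡ sum (map (λ x → sum (map f (g x))) xs)
sum-map-concatMap f g [] = refl
sum-map-concatMap f g (x ∷ xs) = begin
  sum (map f (g x ++ concatMap g xs))
    ≡⟨ cong sum (map-++ f (g x) (concatMap g xs)) ⟩
  sum (map f (g x) ++ map f (concatMap g xs))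
    ≡⟨ sum-++ (map f (g x)) _ ⟩
  sum (map f (g x)) + sum (map f (concatMap g xs))
    ≡⟨ cong (_+_ (sum (map f (g x)))) (sum-map-concatMap f g xs) ⟩
  sum (map f (g x)) + sum (map (λ x → sum (map f (g x))) xs) ∎

applyUpTo-cong : ∀ {A : Set} {f g : ℕ → A} n → (∀ i → i < n → f i ≡ g i) →
                 applyUpTo f n ≡ applyUpTo g n
applyUpTo-cong zero e = refl
applyUpTo-cong (suc n) e =
  cong₂ _∷_ (e 0 (s≤s z≤n)) (applyUpTo-cong n (λ i i<n → e (suc i) (s≤s i<n)))

pairSum : (n : ℕ) → (Vec Bool n → Vec Bool n → ℕ) → ℕ
pairSum n p = sum (map (λ r₀ → sum (map (p r₀) (allVecs n))) (allVecs n))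

pairSum-cong : ∀ n {p q : Vec Bool n → Vec Bool n → ℕ} →
               (∀ r₀ r₁ → p r₀ r₁ ≡ q r₀ r₁) → pairSum n p ≡ pairSum n q
pairSum-cong n e =
  cong sum (map-cong (λ r₀ → cong sum (map-cong (e r₀) (allVecs n))) (allVecs n))

pairSum-+ : ∀ n (p q : Vec Bool n → Vec Bool n → ℕ) →
            pairSum n (λ r₀ r₁ → p r₀ r₁ + q r₀ r₁) ≡ pairSum n p + pairSum n q
pairSum-+ n p q =
  trans (cong sum (map-cong (λ r₀ → sum-map-+ (p r₀) (q r₀) (allVecs n)) (allVecs n)))
        (sum-map-+ _ _ (allVecs n))

pairSum-zero : ∀ n → pairSum n (λ _ _ → 0) ≡ 0
pairSum-zero n =
  trans (cong sum (map-cong (λ _ → sum-map-zero (allVecs n)) (allVecs n)))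
        (sum-map-zero (allVecs n))

sum-allVecs-suc : ∀ n (g : Vec Bool (suc n) → ℕ) →
                  sum (map g (allVecs (suc n))) ≡ sum (map (λ v → g (true ∷ v) + g (false ∷ v)) (allVecs n))
sum-allVecs-suc n g =
  trans (sum-map-concatMap g _ (allVecs n))
        (cong sum (map-cong (λ v → cong (_+_ (g (true ∷ v))) (+-identityʳ (g (false ∷ v)))) (allVecs n)))

pairSum-suc : ∀ n (p : Vec Bool (suc n) → Vec Bool (suc n) → ℕ) →
              pairSum (suc n) p
              ≡ pairSum n (λ r₀ r₁ → (p (true ∷ r₀) (true ∷ r₁) + p (true ∷ r₀) (false ∷ r₁))
                                   + (p (false ∷ r₀) (true ∷ r₁) + p (false ∷ r₀) (false ∷ r₁)))
pairSum-suc n p = begin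
  pairSum (suc n) p
    ≡⟨ sum-allVecs-suc n _ ⟩
  sum (map (λ r₀ → inner (true ∷ r₀) + inner (false ∷ r₀)) (allVecs n))
    ≡⟨ cong sum (map-cong (λ r₀ → cong₂ _+_ (sum-allVecs-suc n (p (true ∷ r₀)))
                                            (sum-allVecs-suc n (p (false ∷ r₀)))) (allVecs n)) ⟩
  sum (map (λ r₀ → sum (map (λ r₁ → p (true ∷ r₀) (true ∷ r₁) + p (true ∷ r₀) (false ∷ r₁)) (allVecs n))
                 + sum (map (λ r₁ → p (false ∷ r₀) (true ∷ r₁) + p (false ∷ r₀) (false ∷ r₁)) (allVecs n)))
           (allVecs n))
    ≡⟨ cong sum (map-cong (λ r₀ → sym (sum-map-+ _ _ (allVecs n))) (allVecs n)) ⟩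
  pairSum n _ ∎
  where
  inner : Vec Bool (suc n) → ℕ
  inner r₀ = sum (map (p r₀) (allVecs (suc n)))

ind : Bool → ℕ
ind b = if b then 1 else 0

-- admissible a b r₀ r₁: the rows r₀, r₁ form an independent set, and none
-- of its first-column cells is next to an occupied cell (a top, b bottom)
-- of a column placed to the left of the grid.
admissible : ∀ {n} → Bool → Bool → Vec Bool n → Vec Bool n → Bool
admissible a b [] [] = true
admissible a b (x ∷ r₀) (y ∷ r₁) =
  not (x ∧ y) ∧ (not (a ∧ x) ∧ (not (b ∧ y) ∧ admissible x y r₀ r₁))

selected : ∀ {n} → Vec Bool n → Vec Bool n → ℕ
selected [] [] = 0
selected (x ∷ r₀) (y ∷ r₁) = ind x + (ind y + selected r₀ r₁)

weight : ∀ {n} → Bool → Bool → ℕ → Vec Bool n → Vec Bool n → ℕ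
weight a b k r₀ r₁ = ind (admissible a b r₀ r₁ ∧ (selected r₀ r₁ ≡ᵇ k))

N : ℕ → Bool → Bool → ℕ → ℕ
N n a b k = pairSum n (weight a b k)

F U L E : ℕ → ℕ → ℕ
F n = N n false false
U n = N n true false
L n = N n false true
E n = N n true true

rows : ∀ {n} → Vec Bool n → Vec Bool n → Selection n
rows r₀ r₁ (i , j) = lookup (lookup r₀ j ∷ lookup r₁ j ∷ []) i

compatible : ∀ {n} → Selection n → Cell n → Cell n → Bool
compatible S c c' = not (adjacent c c' ∧ S c ∧ S c')

Independent : ∀ {n} → Selection n → Set
Independent {n} S = (c c' : Cell n) → compatible S c c' ≡ true

Independent-≗ : ∀ {n} {S S' : Selection n} → S ≗ S' → Independent S → Independent S'
Independent-≗ e q c c' = subst₂ (λ u v → not (adjacent c c' ∧ u ∧ v) ≡ true) (e c) (e c') (q c c')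

∧-left : ∀ {x y} → x ∧ y ≡ true → x ≡ true
∧-left {true} _ = refl

∧-right : ∀ {x y} → x ∧ y ≡ true → y ≡ true
∧-right {true} e = e

∧-intro : ∀ {x y} → x ≡ true → y ≡ true → x ∧ y ≡ true
∧-intro refl e = e

allB-sound : ∀ {A : Set} (p : A → Bool) (xs : List A) → allB p xs ≡ true → ∀ {x} → x ∈ xs → p x ≡ true
allB-sound p (y ∷ ys) h (here refl) = ∧-left h
allB-sound p (y ∷ ys) h (there x∈ys) = allB-sound p ys (∧-right {p y} h) x∈ys

allB-complete : ∀ {A : Set} (p : A → Bool) (xs : List A) → (∀ x → p x ≡ true) → allB p xs ≡ true
allB-complete p [] h = refl
allB-complete p (y ∷ ys) h = ∧-intro (h y) (allB-complete p ys h)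

cells-complete : ∀ {n} (c : Cell n) → c ∈ cells n
cells-complete (fz , j) = ∈-++⁺ˡ (∈-map⁺ (fz ,_) (∈-allFin j))
cells-complete {n} (fs fz , j) =
  ∈-++⁺ʳ (map (fz ,_) (allFin n)) (∈-++⁺ˡ (∈-map⁺ (fs fz ,_) (∈-allFin j)))

nonAdjacent⇔Independent : ∀ {n} (S : Selection n) → nonAdjacent S ≡ true ⇔ Independent S
nonAdjacent⇔Independent {n} S = mk⇔
  (λ h c c' → allB-sound (compatible S c) (cells n)
                 (allB-sound (λ c → allB (compatible S c) (cells n)) (cells n) h (cells-complete c))
                 (cells-complete c'))
  (λ q → allB-complete (λ c → allB (compatible S c) (cells n)) (cells n)
           (λ c → allB-complete (compatible S c) (cells n) (q c)))

drop-column : ∀ {n} a b (r₀ r₁ : Vec Bool n) →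
              Independent (rows (a ∷ r₀) (b ∷ r₁)) → Independent (rows r₀ r₁)
drop-column a b r₀ r₁ q (i , j) (i' , j') = q (i , fs j) (i' , fs j')

first-column : ∀ {n} a b (r₀ r₁ : Vec Bool n) → not (a ∧ b) ≡ true → ∀ i i' →
               compatible (rows (a ∷ r₀) (b ∷ r₁)) (i , fz) (i' , fz) ≡ true
first-column a b r₀ r₁ v fz      fz      = refl
first-column a b r₀ r₁ v fz      (fs fz) = v
first-column a b r₀ r₁ v (fs fz) fz      = trans (cong not (∧-comm b a)) v
first-column a b r₀ r₁ v (fs fz) (fs fz) = refl

prepend-column : ∀ {n} a b x y (r₀ r₁ : Vec Bool n) →
                 not (a ∧ b) ≡ true → not (a ∧ x) ≡ true → not (b ∧ y) ≡ true →
                 Independent (rows (x ∷ r₀) (y ∷ r₁)) → Independent (rows (a ∷ x ∷ r₀) (b ∷ y ∷ r₁))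
prepend-column a b x y r₀ r₁ v t u q (i , fz) (i' , fz) = first-column a b (x ∷ r₀) (y ∷ r₁) v i i'
prepend-column a b x y r₀ r₁ v t u q (i , fs j) (i' , fs j') = q (i , j) (i' , j')
prepend-column a b x y r₀ r₁ v t u q (fz , fz) (fz , fs fz) = t
prepend-column a b x y r₀ r₁ v t u q (fz , fz) (fz , fs (fs _)) = refl
prepend-column a b x y r₀ r₁ v t u q (fz , fz) (fs fz , fs _) = refl
prepend-column a b x y r₀ r₁ v t u q (fs fz , fz) (fz , fs _) = refl
prepend-column a b x y r₀ r₁ v t u q (fs fz , fz) (fs fz , fs fz) = u
prepend-column a b x y r₀ r₁ v t u q (fs fz , fz) (fs fz , fs (fs _)) = refl
prepend-column a b x y r₀ r₁ v t u q (fz , fs fz) (fz , fz) = trans (cong not (∧-comm x a)) t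
prepend-column a b x y r₀ r₁ v t u q (fz , fs (fs _)) (fz , fz) = refl
prepend-column a b x y r₀ r₁ v t u q (fz , fs _) (fs fz , fz) = refl
prepend-column a b x y r₀ r₁ v t u q (fs fz , fs _) (fz , fz) = refl
prepend-column a b x y r₀ r₁ v t u q (fs fz , fs fz) (fs fz , fz) = trans (cong not (∧-comm y b)) u
prepend-column a b x y r₀ r₁ v t u q (fs fz , fs (fs _)) (fs fz , fz) = refl

independent→admissible : ∀ {n} a b (r₀ r₁ : Vec Bool n) →
                         Independent (rows (a ∷ r₀) (b ∷ r₁)) → admissible a b r₀ r₁ ≡ true
independent→admissible a b [] [] q = refl
independent→admissible a b (x ∷ r₀) (y ∷ r₁) q =
  ∧-intro (q (fz , fs fz) (fs fz , fs fz))
  (∧-intro (q (fz , fz) (fz , fs fz))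
  (∧-intro (q (fs fz , fz) (fs fz , fs fz))
           (independent→admissible x y r₀ r₁ (drop-column a b _ _ q))))

admissible→independent : ∀ {n} a b (r₀ r₁ : Vec Bool n) → not (a ∧ b) ≡ true →
                         admissible a b r₀ r₁ ≡ true → Independent (rows (a ∷ r₀) (b ∷ r₁))
admissible→independent a b [] [] v h (i , fz) (i' , fz) = first-column a b [] [] v i i'
admissible→independent a b (x ∷ r₀) (y ∷ r₁) v h =
  prepend-column a b x y r₀ r₁ v (∧-left h₁) (∧-left h₂)
    (admissible→independent x y r₀ r₁ (∧-left h) (∧-right {not (b ∧ y)} h₂))
  where
  h₁ = ∧-right {not (x ∧ y)} h
  h₂ = ∧-right {not (a ∧ x)} h₁

Independent⇔admissible : ∀ {n} (r₀ r₁ : Vec Bool n) →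
                         Independent (rows r₀ r₁) ⇔ admissible false false r₀ r₁ ≡ true
Independent⇔admissible [] [] = mk⇔ (λ _ → refl) (λ { _ (_ , ()) })
Independent⇔admissible (x ∷ r₀) (y ∷ r₁) = mk⇔
  (λ q → ∧-intro (q (fz , fz) (fs fz , fz)) (independent→admissible x y r₀ r₁ q))
  (λ h → admissible→independent x y r₀ r₁ (∧-left h) (∧-right {not (x ∧ y)} h))

nonAdjacent-rows : ∀ {n} (r₀ r₁ : Vec Bool n) (S : Selection n) → S ≗ rows r₀ r₁ →
                   nonAdjacent S ≡ admissible false false r₀ r₁
nonAdjacent-rows r₀ r₁ S e = ⇔→≡ (mk⇔
  (λ h → to (Independent⇔admissible r₀ r₁) (Independent-≗ e (to (nonAdjacent⇔Independent S) h)))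
  (λ h → from (nonAdjacent⇔Independent S)
           (Independent-≗ (λ c → sym (e c)) (from (Independent⇔admissible r₀ r₁) h))))
  where open Equivalence

count : ∀ {n} → Vec Bool n → ℕ
count [] = 0
count (x ∷ r) = ind x + count r

count-lookup : ∀ {n} (r : Vec Bool n) → sum (tabulate (λ j → ind (lookup r j))) ≡ count r
count-lookup [] = refl
count-lookup (x ∷ r) = cong (_+_ (ind x)) (count-lookup r)

count-row : ∀ {n} (r : Vec Bool n) → sum (map (λ j → ind (lookup r j)) (allFin n)) ≡ count r
count-row r = trans (cong sum (map-tabulate (λ j → j) (λ j → ind (lookup r j)))) (count-lookup r)

count-selected : ∀ {n} (r₀ r₁ : Vec Bool n) → count r₀ + count r₁ ≡ selected r₀ r₁
count-selected [] [] = refl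
count-selected (x ∷ r₀) (y ∷ r₁) = begin
  (ind x + count r₀) + (ind y + count r₁) ≡⟨ interchange +-commutativeSemigroup (ind x) _ _ _ ⟩
  (ind x + ind y) + (count r₀ + count r₁) ≡⟨ +-assoc (ind x) _ _ ⟩
  ind x + (ind y + (count r₀ + count r₁)) ≡⟨ cong (λ s → ind x + (ind y + s)) (count-selected r₀ r₁) ⟩
  ind x + (ind y + selected r₀ r₁)        ∎

size-rows : ∀ {n} (r₀ r₁ : Vec Bool n) (S : Selection n) → S ≗ rows r₀ r₁ → size S ≡ selected r₀ r₁
size-rows {n} r₀ r₁ S e = begin
  size S
    ≡⟨ cong sum (map-cong (λ c → cong ind (e c)) (cells n)) ⟩
  sum (map (λ c → ind (rows r₀ r₁ c)) (cells n))
    ≡⟨ sum-map-concatMap (λ c → ind (rows r₀ r₁ c)) (λ i → map (i ,_) (allFin n)) (allFin 2) ⟩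
  row fz + (row (fs fz) + 0)
    ≡⟨ cong₂ (λ s t → s + (t + 0)) (row-count fz r₀ (λ _ → refl)) (row-count (fs fz) r₁ (λ _ → refl)) ⟩
  count r₀ + (count r₁ + 0)
    ≡⟨ cong (_+_ (count r₀)) (+-identityʳ (count r₁)) ⟩
  count r₀ + count r₁
    ≡⟨ count-selected r₀ r₁ ⟩
  selected r₀ r₁ ∎
  where
  row : Fin 2 → ℕ
  row i = sum (map (λ c → ind (rows r₀ r₁ c)) (map (i ,_) (allFin n)))
  row-count : ∀ i r → (∀ j → rows r₀ r₁ (i , j) ≡ lookup r j) → row i ≡ count r
  row-count i r e' = trans (cong sum (sym (map-∘ (allFin n))))
                           (trans (cong sum (map-cong (λ j → cong ind (e' j)) (allFin n))) (count-row r))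

sum-selections : ∀ n (f : Selection n → ℕ) (g : Vec Bool n → Vec Bool n → ℕ) →
                 (∀ r₀ r₁ (S : Selection n) → S ≗ rows r₀ r₁ → f S ≡ g r₀ r₁) →
                 sum (map f (selections n)) ≡ pairSum n g
sum-selections n f g e =
  trans (sum-map-concatMap f _ (allVecs n))
        (cong sum (map-cong (λ r₀ → trans (cong sum (sym (map-∘ (allVecs n))))
                                          (cong sum (map-cong (λ r₁ → e r₀ r₁ _ (λ where
                                             -- the selection built in Defs from r₀, r₁ is rows r₀ r₁
                                             (fz , _) → refl
                                             (fs fz , _) → refl))
                                            (allVecs n))))
                            (allVecs n)))

T2≡F : ∀ n k → T2 n k ≡ F n k
T2≡F n k = sum-selections n _ (weight false false k)
  λ r₀ r₁ S e → cong₂ (λ u s → ind (u ∧ (s ≡ᵇ k))) (nonAdjacent-rows r₀ r₁ S e) (size-rows r₀ r₁ S e)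

-- shift f k = f (k - 1), and 0 when k = 0: the count after using one square.
shift : (ℕ → ℕ) → ℕ → ℕ
shift f zero = 0
shift f (suc k) = f k

ifFree : Bool → ℕ → ℕ
ifFree true x = 0
ifFree false x = x

top-only : ∀ {n} a b k (r₀ r₁ : Vec Bool n) →
           weight a b k (true ∷ r₀) (false ∷ r₁) ≡ ifFree a (shift (λ j → weight true false j r₀ r₁) k)
top-only true b k r₀ r₁ = refl
top-only false b zero r₀ r₁ = cong ind (∧-zeroʳ _)
top-only false true (suc k) r₀ r₁ = refl
top-only false false (suc k) r₀ r₁ = refl

bottom-only : ∀ {n} a b k (r₀ r₁ : Vec Bool n) →
              weight a b k (false ∷ r₀) (true ∷ r₁) ≡ ifFree b (shift (λ j → weight false true j r₀ r₁) k)
bottom-only true true k r₀ r₁ = refl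
bottom-only false true k r₀ r₁ = refl
bottom-only a false zero r₀ r₁ = cong ind (∧-zeroʳ _)
bottom-only true false (suc k) r₀ r₁ = refl
bottom-only false false (suc k) r₀ r₁ = refl

empty-column : ∀ {n} a b k (r₀ r₁ : Vec Bool n) →
               weight a b k (false ∷ r₀) (false ∷ r₁) ≡ weight false false k r₀ r₁
empty-column true true k r₀ r₁ = refl
empty-column true false k r₀ r₁ = refl
empty-column false true k r₀ r₁ = refl
empty-column false false k r₀ r₁ = refl

pairSum-ifFree-shift : ∀ n a k (p : ℕ → Vec Bool n → Vec Bool n → ℕ) →
                       pairSum n (λ r₀ r₁ → ifFree a (shift (λ j → p j r₀ r₁) k))
                       ≡ ifFree a (shift (λ j → pairSum n (p j)) k)
pairSum-ifFree-shift n true k p = pairSum-zero n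
pairSum-ifFree-shift n false zero p = pairSum-zero n
pairSum-ifFree-shift n false (suc k) p = refl

-- Transfer recurrence: classify by the content of the first column (a full
-- column is never admissible).
N-suc : ∀ n a b k → N (suc n) a b k ≡ ifFree a (shift (U n) k) + (ifFree b (shift (L n) k) + F n k)
N-suc n a b k = begin
  N (suc n) a b k
    ≡⟨ pairSum-suc n (weight a b k) ⟩
  pairSum n (λ r₀ r₁ → weight a b k (true ∷ r₀) (false ∷ r₁)
                       + (weight a b k (false ∷ r₀) (true ∷ r₁) + weight a b k (false ∷ r₀) (false ∷ r₁)))
    ≡⟨ pairSum-cong n (λ r₀ r₁ → cong₂ _+_ (top-only a b k r₀ r₁)
                                   (cong₂ _+_ (bottom-only a b k r₀ r₁) (empty-column a b k r₀ r₁))) ⟩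
  pairSum n (λ r₀ r₁ → ifFree a (shift (λ j → weight true false j r₀ r₁) k)
                       + (ifFree b (shift (λ j → weight false true j r₀ r₁) k) + weight false false k r₀ r₁))
    ≡⟨ pairSum-+ n _ _ ⟩
  _ + pairSum n (λ r₀ r₁ → ifFree b (shift (λ j → weight false true j r₀ r₁) k) + weight false false k r₀ r₁)
    ≡⟨ cong₂ _+_ (pairSum-ifFree-shift n a k (λ j → weight true false j))
                 (trans (pairSum-+ n _ _) (cong (_+ F n k) (pairSum-ifFree-shift n b k (λ j → weight false true j)))) ⟩
  ifFree a (shift (U n) k) + (ifFree b (shift (L n) k) + F n k) ∎

U≡L : ∀ n k → U n k ≡ L n k
U≡L zero zero = refl
U≡L zero (suc k) = refl
U≡L (suc n) zero = trans (N-suc n true false 0) (sym (N-suc n false true 0))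
U≡L (suc n) (suc k) = begin
  U (suc n) (suc k)      ≡⟨ N-suc n true false (suc k) ⟩
  L n k + F n (suc k)    ≡⟨ cong (_+ F n (suc k)) (sym (U≡L n k)) ⟩
  U n k + F n (suc k)    ≡⟨ sym (N-suc n false true (suc k)) ⟩
  L (suc n) (suc k)      ∎

U+L≡E+F : ∀ n k → U n k + L n k ≡ E n k + F n k
U+L≡E+F zero zero = refl
U+L≡E+F zero (suc k) = refl
U+L≡E+F (suc n) k = begin
  U (suc n) k + L (suc n) k
    ≡⟨ cong₂ _+_ (N-suc n true false k) (N-suc n false true k) ⟩
  (shift (L n) k + F n k) + (shift (U n) k + F n k)
    ≡⟨ rearrange (shift (L n) k) (shift (U n) k) (F n k) ⟩
  F n k + (shift (U n) k + (shift (L n) k + F n k))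
    ≡⟨ cong₂ _+_ (sym (N-suc n true true k)) (sym (N-suc n false false k)) ⟩
  E (suc n) k + F (suc n) k ∎
  where
  rearrange : ∀ l u f → (l + f) + (u + f) ≡ f + (u + (l + f))
  rearrange = solve-∀

F-suc-E : ∀ m k → F (suc m) k ≡ shift (E m) k + shift (F m) k + F m k
F-suc-E m zero = N-suc m false false 0
F-suc-E m (suc j) = begin
  F (suc m) (suc j)                   ≡⟨ N-suc m false false (suc j) ⟩
  U m j + (L m j + F m (suc j))       ≡⟨ sym (+-assoc (U m j) _ _) ⟩
  U m j + L m j + F m (suc j)         ≡⟨ cong (_+ F m (suc j)) (U+L≡E+F m j) ⟩
  E m j + F m j + F m (suc j)         ∎

F-suc-U : ∀ m k → F (suc m) k ≡ F m k + 2 * shift (U m) k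
F-suc-U m zero = trans (N-suc m false false 0) (sym (+-identityʳ (F m 0)))
F-suc-U m (suc j) = begin
  F (suc m) (suc j)                   ≡⟨ N-suc m false false (suc j) ⟩
  U m j + (L m j + F m (suc j))       ≡⟨ cong (λ l → U m j + (l + F m (suc j))) (sym (U≡L m j)) ⟩
  U m j + (U m j + F m (suc j))       ≡⟨ double (U m j) (F m (suc j)) ⟩
  F m (suc j) + 2 * U m j             ∎
  where
  double : ∀ u f → u + (u + f) ≡ f + 2 * u
  double = solve-∀

-- Unfolding U: the blocked top cell stays empty, or the top row is used up
-- to some column i, after which the next column is blocked.
U-as-sum : ∀ m j → j ≤ m → U m j ≡ sum (applyUpTo (λ i → E (m ∸ i) (j ∸ i)) (suc j))
U-as-sum zero zero _ = refl
U-as-sum (suc m) zero _ = begin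
  U (suc m) 0              ≡⟨ N-suc m true false 0 ⟩
  F m 0                    ≡⟨ sym (N-suc m true true 0) ⟩
  E (suc m) 0              ≡⟨ sym (+-identityʳ _) ⟩
  E (suc m) 0 + 0          ∎
U-as-sum (suc m) (suc j) (s≤s j≤m) = begin
  U (suc m) (suc j)                           ≡⟨ N-suc m true false (suc j) ⟩
  L m j + F m (suc j)                         ≡⟨ cong (_+ F m (suc j)) (sym (U≡L m j)) ⟩
  U m j + F m (suc j)                         ≡⟨ cong₂ _+_ (U-as-sum m j j≤m) (sym (N-suc m true true (suc j))) ⟩
  sum (applyUpTo (λ i → E (m ∸ i) (j ∸ i)) (suc j)) + E (suc m) (suc j)
                                              ≡⟨ +-comm _ (E (suc m) (suc j)) ⟩
  E (suc m) (suc j) + sum (applyUpTo (λ i → E (m ∸ i) (j ∸ i)) (suc j)) ∎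

T-negative : ∀ z j → T z -[1+ j ] ≡ 0
T-negative (+ n) j = refl
T-negative -[1+ zero ] j = refl
T-negative -[1+ suc n ] j = refl

-- T(2,m-1;j) is E m j, including the convention T(2,-1;j) = [j = 0].
T-pred : ∀ m j → T (+ m - + 1) (+ j) ≡ E m j
T-pred zero zero = refl
T-pred zero (suc j) = refl
T-pred (suc m) j = trans (T2≡F m j) (sym (N-suc m true true j))

T-lower : ∀ z (f : ℕ → ℕ) → (∀ j → T z (+ j) ≡ f j) → ∀ k → T z (+ k - + 1) ≡ shift f k
T-lower z f e zero = T-negative z 0
T-lower z f e (suc j) = e j

T-pred-lower : ∀ m k → T (+ suc m - + 2) (+ k - + 1) ≡ shift (E m) k
T-pred-lower m k = trans (cong (λ z → T z (+ k - + 1)) ([1+m]⊖[1+n]≡m⊖n m 1))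
                         (T-lower (+ m - + 1) (E m) (T-pred m) k)

T-term : ∀ m j i → i ≤ j → j ≤ m → T (+ suc m - + suc i - + 1) (+ suc j - + suc i) ≡ E (m ∸ i) (j ∸ i)
T-term m j i i≤j j≤m =
  trans (cong₂ (λ z w → T (z - + 1) w) (⊖-≥ (s≤s (≤-trans i≤j j≤m))) (⊖-≥ (s≤s i≤j)))
        (T-pred (m ∸ i) (j ∸ i))

sum-T : ∀ m k → k ≤ suc m →
        sum (map (λ r → 2 * T (+ suc m - + r - + 1) (+ k - + r)) (applyUpTo suc k)) ≡ 2 * shift (U m) k
sum-T m zero _ = refl
sum-T m (suc j) (s≤s j≤m) = begin
  sum (map (λ r → 2 * term r) (applyUpTo suc (suc j)))     ≡⟨ sum-map-* 2 term (applyUpTo suc (suc j)) ⟩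
  2 * sum (map term (applyUpTo suc (suc j)))               ≡⟨ cong (λ s → 2 * sum s) (map-applyUpTo suc term (suc j)) ⟩
  2 * sum (applyUpTo (λ i → term (suc i)) (suc j))         ≡⟨ cong (λ s → 2 * sum s) (applyUpTo-cong (suc j)
                                                                 λ { i (s≤s i≤j) → T-term m j i i≤j j≤m }) ⟩
  2 * sum (applyUpTo (λ i → E (m ∸ i) (j ∸ i)) (suc j))    ≡⟨ cong (2 *_) (sym (U-as-sum m j j≤m)) ⟩
  2 * U m j                                                ∎
  where
  term : ℕ → ℕ
  term r = T (+ suc m - + r - + 1) (+ suc j - + r)

proposition4 :
    ((n k : ℕ) → 1 ≤ n →
      T (+ n) (+ k) ≡ T (+ n - + 2) (+ k - + 1) + T (+ n - + 1) (+ k - + 1) + T (+ n - + 1) (+ k))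
    × ((n k : ℕ) → 1 ≤ n → k ≤ n →
      T (+ n) (+ k) ≡ T (+ n - + 1) (+ k)
        + sum (map (λ r → 2 * T (+ n - + r - + 1) (+ k - + r)) (applyUpTo suc k)))
proposition4 = part-a , part-b
  where
  part-a : (n k : ℕ) → 1 ≤ n →
           T (+ n) (+ k) ≡ T (+ n - + 2) (+ k - + 1) + T (+ n - + 1) (+ k - + 1) + T (+ n - + 1) (+ k)
  part-a (suc m) k _ = begin
    T (+ suc m) (+ k)                                    ≡⟨ T2≡F (suc m) k ⟩
    F (suc m) k                                          ≡⟨ F-suc-E m k ⟩
    shift (E m) k + shift (F m) k + F m k
      ≡⟨ sym (cong₂ _+_ (cong₂ _+_ (T-pred-lower m k) (T-lower (+ m) (F m) (T2≡F m) k)) (T2≡F m k)) ⟩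
    T (+ suc m - + 2) (+ k - + 1) + T (+ suc m - + 1) (+ k - + 1) + T (+ suc m - + 1) (+ k) ∎
  part-b : (n k : ℕ) → 1 ≤ n → k ≤ n →
           T (+ n) (+ k) ≡ T (+ n - + 1) (+ k)
             + sum (map (λ r → 2 * T (+ n - + r - + 1) (+ k - + r)) (applyUpTo suc k))
  part-b (suc m) k _ k≤n = begin
    T (+ suc m) (+ k)                      ≡⟨ T2≡F (suc m) k ⟩
    F (suc m) k                            ≡⟨ F-suc-U m k ⟩
    F m k + 2 * shift (U m) k              ≡⟨ sym (cong₂ _+_ (T2≡F m k) (sum-T m k k≤n)) ⟩
    T (+ suc m - + 1) (+ k) + sum (map (λ r → 2 * T (+ suc m - + r - + 1) (+ k - + r)) (applyUpTo suc k)) ∎
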